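{- Let $1\le p\le k\le m$ and $N\ge 1$ be integers. Let $D$ consist of $N$ reads, each chosen independently and uniformly at random from $\{0,1,2,3\}^m$, and let $n=Nm$. Let $T$ be the total partition size of $D$ under minimum substring partitioning with parameters $k,p$, i.e. the sum of the lengths of all super $k$-mers of all reads. Then the expected total partition size is $O(pn)$: there is an absolute constant $C$ (independent of $p,k,m,N$) such that $\mathbb{E}[T]\le C\,p\,n$.
   Context: Strings of equal length over the alphabet $\{0,1,2,3\}$ (ordered $0<1<2<3$) are compared lexicographically. $s[i,j]$ denotes $s_i\cdots s_j$. For a string $u$ of length at least $p$, $\min_p(u)$ is the lexicographically smallest length-$p$ substring of $u$. The $k$-mers of a read $s$ of length $m$ are $s[i,i+k-1]$, $1\le i\le m-k+1$. Minimum substring partitioning splits the sequence of $k$-mers of $s$ into maximal runs of consecutive $k$-mers with the same minimum $p$-substring; a run consisting of the $k$-mers starting at positions $i,\dots,j-k+1$ corresponds to the substring $s[i,j]$, called a super $k$-mer. -}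

module Defs where

open import Data.Nat using (ℕ; zero; suc; _+_; _*_; _∸_; _≤ᵇ_; _<ᵇ_)
open import Data.Bool using (Bool; true; false; if_then_else_)
open import Data.Fin using (Fin; toℕ)
import Data.Fin as Fin
open import Data.List using (List; []; _∷_; map; concatMap; foldr; length; take; drop; allFin)
open import Data.Nat.ListAction using (sum)
import Data.List.Properties as LP
open import Data.Product using (_×_; _,_)
open import Relation.Nullary using (yes; no)

Letter : Set
Letter = Fin 4

Word : Set
Word = List Letter

lexLeq : Word → Word → Bool
lexLeq [] _ = true
lexLeq (x ∷ xs) [] = false
lexLeq (x ∷ xs) (y ∷ ys) =
  if toℕ x <ᵇ toℕ y then true
  else (if toℕ y <ᵇ toℕ x then false else lexLeq xs ys)

lexMin : Word → Word → Word
lexMin u v = if lexLeq u v then u else v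

windows : ℕ → Word → List Word
windows p [] = []
windows p (x ∷ xs) =
  if p ≤ᵇ length (x ∷ xs) then take p (x ∷ xs) ∷ windows p xs else []

-- min_p(u): lexicographically smallest length-p substring (u assumed |u| ≥ p)
minP : ℕ → Word → Word
minP p u = foldr lexMin (take p u) (windows p u)

-- maximal runs of consecutive equal elements: list of (start index (0-based), run length)
runsGo : ℕ → Word → ℕ → ℕ → List Word → List (ℕ × ℕ)
runsGo i cur st len [] = (st , len) ∷ []
runsGo i cur st len (x ∷ xs) with LP.≡-dec Fin._≟_ x cur
... | yes _ = runsGo (suc i) cur st (suc len) xs
... | no _  = (st , len) ∷ runsGo (suc i) x i 1 xs

runs : List Word → List (ℕ × ℕ)
runs [] = []
runs (x ∷ xs) = runsGo 1 x 0 1 xs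

kmers : ℕ → Word → List Word
kmers k s = windows k s

-- super k-mers of read s: a run of r k-mers starting at (0-based) position i
-- corresponds to the substring s[i, i+r+k-2] (length r+k-1)
superKmers : ℕ → ℕ → Word → List Word
superKmers k p s =
  map (λ { (i , r) → take (r + k ∸ 1) (drop i s) })
      (runs (map (minP p) (kmers k s)))

partitionSize : ℕ → ℕ → Word → ℕ
partitionSize k p s = sum (map length (superKmers k p s))

totalPartitionSize : ℕ → ℕ → List Word → ℕ
totalPartitionSize k p D = sum (map (partitionSize k p) D)

allReads : ℕ → List Word
allReads zero = [] ∷ []
allReads (suc m) = concatMap (λ x → map (x ∷_) (allReads m)) (allFin 4)

allDatasets : ℕ → ℕ → List (List Word)
allDatasets zero m = [] ∷ []
allDatasets (suc N) m = concatMap (λ r → map (r ∷_) (allDatasets N m)) (allReads m)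

-- sum of T over all equally likely datasets = 4^(mN) · E[T]
sumTotalPartitionSize : ℕ → ℕ → ℕ → ℕ → ℕ
sumTotalPartitionSize k p m N = sum (map (totalPartitionSize k p) (allDatasets N m))

-- Expectations are replaced by sums over all 4^m equally likely reads. For one read s the
-- super k-mers correspond to the maximal runs of k-mers with equal min_p, so the partition
-- size is at most |s| + k plus k for every (k+1)-window of s across which min_p changes
-- (partitionSize-bound). The heart of the proof, minChange-density, shows that min_p changes
-- across a uniformly random (k+1)-mer with probability at most 4p/k: writing
-- k + 1 = p + q·p + t with t < p, a change forces the first or the last p-window to lie strictly
-- below q disjoint p-blocks (minChange-covered, via the order-theoretic slidingMin-stable),
-- each of which has probability at most 1/(q+1) by symmetry (strictMinCount-bound), while
-- k ≤ 2p(q+1). Every (k+1)-window of a uniform read is a uniform word (windowSum-average), so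
-- summing over reads gives at most 6·p·m·4^m (readSum-bound), and summing over datasets of N
-- independent reads (datasetSum) yields the corollary with C = 6.
module Submission where

open import Defs
open import Data.Nat using (ℕ; _*_; _^_; _≤_)
open import Data.Product using (Σ)

open import Data.Nat using (zero; suc; _+_; _∸_; _<_; _≤ᵇ_; _<ᵇ_; z≤n; s≤s)
open import Data.Nat.Properties
open import Data.Nat.DivMod using (_/_; _%_; m≡m%n+[m/n]*n; m%n<n)
open import Data.Nat.Tactic.RingSolver using (solve-∀)
open import Data.Fin using (toℕ)
open import Data.List using (List; []; _∷_; map; concatMap; foldr; length; take; drop; allFin; _++_)
open import Data.List.Membership.Propositional using (_∈_)
open import Data.List.Relation.Unary.Any using (here; there)
open import Data.Nat.ListAction using (sum)
import Data.List.Properties as LP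
open import Data.Bool using (true; false; if_then_else_; T)
open import Data.Product using (_×_; _,_; proj₁; proj₂; ∃)
open import Data.Sum using (_⊎_; inj₁; inj₂)
open import Data.Empty using (⊥-elim)
import Data.Fin.Properties as FinP
import Data.Fin as Fin
open import Relation.Nullary using (yes; no; ¬_)
open import Relation.Binary.Definitions using (tri<; tri≈; tri>)
open import Relation.Binary.PropositionalEquality

sumList : {A : Set} → (A → ℕ) → List A → ℕ
sumList f xs = sum (map f xs)

module _ {A : Set} where

  sumList-cong : ∀ {f g : A → ℕ} xs → (∀ x → f x ≡ g x) → sumList f xs ≡ sumList g xs
  sumList-cong [] eq = refl
  sumList-cong (x ∷ xs) eq = cong₂ _+_ (eq x) (sumList-cong xs eq)

  sumList-mono : ∀ {f g : A → ℕ} xs → (∀ x → f x ≤ g x) → sumList f xs ≤ sumList g xs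
  sumList-mono [] le = z≤n
  sumList-mono (x ∷ xs) le = +-mono-≤ (le x) (sumList-mono xs le)

  sumList-+ : ∀ (f g : A → ℕ) xs → sumList (λ x → f x + g x) xs ≡ sumList f xs + sumList g xs
  sumList-+ f g [] = refl
  sumList-+ f g (x ∷ xs) rewrite sumList-+ f g xs = interchange (f x) (g x) (sumList f xs) (sumList g xs)
    where
    interchange : ∀ a b c d → a + b + (c + d) ≡ a + c + (b + d)
    interchange = solve-∀

  sumList-*ˡ : ∀ c (f : A → ℕ) xs → sumList (λ x → c * f x) xs ≡ c * sumList f xs
  sumList-*ˡ c f [] = sym (*-zeroʳ c)
  sumList-*ˡ c f (x ∷ xs) rewrite sumList-*ˡ c f xs = sym (*-distribˡ-+ c (f x) _)

  sumList-const : ∀ c (xs : List A) → sumList (λ _ → c) xs ≡ length xs * c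
  sumList-const c [] = refl
  sumList-const c (x ∷ xs) = cong (c +_) (sumList-const c xs)

  sumList-++ : ∀ (f : A → ℕ) xs ys → sumList f (xs ++ ys) ≡ sumList f xs + sumList f ys
  sumList-++ f [] ys = refl
  sumList-++ f (x ∷ xs) ys rewrite sumList-++ f xs ys = sym (+-assoc (f x) _ _)

sumList-map : {A B : Set} (f : B → ℕ) (g : A → B) (xs : List A) → sumList f (map g xs) ≡ sumList (λ x → f (g x)) xs
sumList-map f g xs = cong sum (sym (LP.map-∘ xs))

sumList-concatMap : {A B : Set} (f : B → ℕ) (g : A → List B) (xs : List A) →
  sumList f (concatMap g xs) ≡ sumList (λ x → sumList f (g x)) xs
sumList-concatMap f g [] = refl
sumList-concatMap f g (x ∷ xs) =
  trans (sumList-++ f (g x) (concatMap g xs)) (cong (sumList f (g x) +_) (sumList-concatMap f g xs))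

sumWords : ℕ → (Word → ℕ) → ℕ
sumWords zero f = f []
sumWords (suc n) f = sumList (λ x → sumWords n (λ u → f (x ∷ u))) (allFin 4)

sumWords-allReads : ∀ n f → sumList f (allReads n) ≡ sumWords n f
sumWords-allReads zero f = +-identityʳ (f [])
sumWords-allReads (suc n) f = begin
    sumList f (concatMap (λ x → map (x ∷_) (allReads n)) (allFin 4))
  ≡⟨ sumList-concatMap f (λ x → map (x ∷_) (allReads n)) (allFin 4) ⟩
    sumList (λ x → sumList f (map (x ∷_) (allReads n))) (allFin 4)
  ≡⟨ sumList-cong (allFin 4) (λ x → trans (sumList-map f (x ∷_) (allReads n))
                                           (sumWords-allReads n (λ u → f (x ∷ u)))) ⟩
    sumWords (suc n) f ∎
  where open ≡-Reasoning

sumWords-cong : ∀ n {f g : Word → ℕ} → (∀ u → length u ≡ n → f u ≡ g u) → sumWords n f ≡ sumWords n g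
sumWords-cong zero eq = eq [] refl
sumWords-cong (suc n) eq =
  sumList-cong (allFin 4) (λ x → sumWords-cong n (λ u len → eq (x ∷ u) (cong suc len)))

sumWords-mono : ∀ n {f g : Word → ℕ} → (∀ u → length u ≡ n → f u ≤ g u) → sumWords n f ≤ sumWords n g
sumWords-mono zero le = le [] refl
sumWords-mono (suc n) le =
  sumList-mono (allFin 4) (λ x → sumWords-mono n (λ u len → le (x ∷ u) (cong suc len)))

sumWords-+ : ∀ n (f g : Word → ℕ) → sumWords n (λ u → f u + g u) ≡ sumWords n f + sumWords n g
sumWords-+ zero f g = refl
sumWords-+ (suc n) f g = trans
  (sumList-cong (allFin 4) (λ x → sumWords-+ n (λ u → f (x ∷ u)) (λ u → g (x ∷ u))))
  (sumList-+ (λ x → sumWords n (λ u → f (x ∷ u))) (λ x → sumWords n (λ u → g (x ∷ u))) (allFin 4))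

sumWords-*ˡ : ∀ n c (f : Word → ℕ) → sumWords n (λ u → c * f u) ≡ c * sumWords n f
sumWords-*ˡ zero c f = refl
sumWords-*ˡ (suc n) c f = trans
  (sumList-cong (allFin 4) (λ x → sumWords-*ˡ n c (λ u → f (x ∷ u))))
  (sumList-*ˡ c (λ x → sumWords n (λ u → f (x ∷ u))) (allFin 4))

sumWords-*ʳ : ∀ n c (f : Word → ℕ) → sumWords n (λ u → f u * c) ≡ sumWords n f * c
sumWords-*ʳ n c f = trans (sumWords-cong n (λ u _ → *-comm (f u) c)) (trans (sumWords-*ˡ n c f) (*-comm c _))

sumWords-const : ∀ n c → sumWords n (λ _ → c) ≡ 4 ^ n * c
sumWords-const zero c = sym (+-identityʳ c)
sumWords-const (suc n) c = begin
    sumList (λ _ → sumWords n (λ _ → c)) (allFin 4)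
  ≡⟨ sumList-cong (allFin 4) (λ _ → sumWords-const n c) ⟩
    sumList (λ _ → 4 ^ n * c) (allFin 4)
  ≡⟨ sumList-const (4 ^ n * c) (allFin 4) ⟩
    4 * (4 ^ n * c)
  ≡⟨ sym (*-assoc 4 (4 ^ n) c) ⟩
    4 ^ suc n * c ∎
  where open ≡-Reasoning

sumWords-split : ∀ a b f → sumWords (a + b) f ≡ sumWords a (λ u → sumWords b (λ v → f (u ++ v)))
sumWords-split zero b f = refl
sumWords-split (suc a) b f = sumList-cong (allFin 4) (λ x → sumWords-split a b (λ u → f (x ∷ u)))

sumWords-sumList : {A : Set} (n : ℕ) (g : A → Word → ℕ) (xs : List A) →
  sumWords n (λ u → sumList (λ x → g x u) xs) ≡ sumList (λ x → sumWords n (g x)) xs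
sumWords-sumList n g [] = trans (sumWords-const n 0) (*-zeroʳ (4 ^ n))
sumWords-sumList n g (x ∷ xs) =
  trans (sumWords-+ n (g x) _) (cong (sumWords n (g x) +_) (sumWords-sumList n g xs))

sumWords-swap : ∀ a b (f : Word → Word → ℕ) →
  sumWords a (λ u → sumWords b (f u)) ≡ sumWords b (λ v → sumWords a (λ u → f u v))
sumWords-swap zero b f = refl
sumWords-swap (suc a) b f = begin
    sumList (λ x → sumWords a (λ u → sumWords b (f (x ∷ u)))) (allFin 4)
  ≡⟨ sumList-cong (allFin 4) (λ x → sumWords-swap a b (λ u → f (x ∷ u))) ⟩
    sumList (λ x → sumWords b (λ v → sumWords a (λ u → f (x ∷ u) v))) (allFin 4)
  ≡⟨ sym (sumWords-sumList b (λ x v → sumWords a (λ u → f (x ∷ u) v)) (allFin 4)) ⟩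
    sumWords b (λ v → sumWords (suc a) (λ u → f u v)) ∎
  where open ≡-Reasoning

sumWords-prefix : ∀ a b (f : Word → ℕ) (g : Word → ℕ) → (∀ u v → length u ≡ a → f (u ++ v) ≡ g u) →
  sumWords (a + b) f ≡ 4 ^ b * sumWords a g
sumWords-prefix a b f g eq = begin
    sumWords (a + b) f
  ≡⟨ sumWords-split a b f ⟩
    sumWords a (λ u → sumWords b (λ v → f (u ++ v)))
  ≡⟨ sumWords-cong a (λ u len → trans (sumWords-cong b (λ v _ → eq u v len)) (sumWords-const b (g u))) ⟩
    sumWords a (λ u → 4 ^ b * g u)
  ≡⟨ sumWords-*ˡ a (4 ^ b) g ⟩
    4 ^ b * sumWords a g ∎
  where open ≡-Reasoning

sumWords-suffix : ∀ a b (f : Word → ℕ) (g : Word → ℕ) → (∀ u v → length u ≡ a → f (u ++ v) ≡ g v) →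
  sumWords (a + b) f ≡ 4 ^ a * sumWords b g
sumWords-suffix a b f g eq = begin
    sumWords (a + b) f
  ≡⟨ sumWords-split a b f ⟩
    sumWords a (λ u → sumWords b (λ v → f (u ++ v)))
  ≡⟨ sumWords-cong a (λ u len → sumWords-cong b (λ v _ → eq u v len)) ⟩
    sumWords a (λ _ → sumWords b g)
  ≡⟨ sumWords-const a (sumWords b g) ⟩
    4 ^ a * sumWords b g ∎
  where open ≡-Reasoning

sumTo : ℕ → (ℕ → ℕ) → ℕ
sumTo zero g = 0
sumTo (suc n) g = g 0 + sumTo n (λ i → g (suc i))

sumTo-cong : ∀ n {f g : ℕ → ℕ} → (∀ i → f i ≡ g i) → sumTo n f ≡ sumTo n g
sumTo-cong zero eq = refl
sumTo-cong (suc n) eq = cong₂ _+_ (eq 0) (sumTo-cong n (λ i → eq (suc i)))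

sumTo-split : ∀ a b g → sumTo (a + b) g ≡ sumTo a g + sumTo b (λ i → g (a + i))
sumTo-split zero b g = refl
sumTo-split (suc a) b g = trans (cong (g 0 +_) (sumTo-split a b (λ i → g (suc i)))) (sym (+-assoc (g 0) _ _))

sumTo-blocks : ∀ b P g → sumTo (b * P) g ≡ sumTo b (λ c → sumTo P (λ i → g (c * P + i)))
sumTo-blocks zero P g = refl
sumTo-blocks (suc b) P g = begin
    sumTo (P + b * P) g
  ≡⟨ sumTo-split P (b * P) g ⟩
    sumTo P g + sumTo (b * P) (λ i → g (P + i))
  ≡⟨ cong (sumTo P g +_) (sumTo-blocks b P (λ i → g (P + i))) ⟩
    sumTo P g + sumTo b (λ c → sumTo P (λ i → g (P + (c * P + i))))
  ≡⟨ cong (sumTo P g +_) (sumTo-cong b (λ c → sumTo-cong P (λ i → cong g (sym (+-assoc P (c * P) i))))) ⟩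
    sumTo (suc b) (λ c → sumTo P (λ i → g (c * P + i))) ∎
  where open ≡-Reasoning

take-++ : ∀ n (v y : Word) → n ≤ length v → take n (v ++ y) ≡ take n v
take-++ zero v y _ = refl
take-++ (suc n) (x ∷ v) y (s≤s n≤) = cong (x ∷_) (take-++ n v y n≤)

drop-++ : ∀ n (v y : Word) → n ≤ length v → drop n (v ++ y) ≡ drop n v ++ y
drop-++ zero v y _ = refl
drop-++ (suc n) (x ∷ v) y (s≤s n≤) = drop-++ n v y n≤

take-prefix : ∀ (u v : Word) {a} → length u ≡ a → take a (u ++ v) ≡ u
take-prefix [] v refl = refl
take-prefix (x ∷ u) v refl = cong (x ∷_) (take-prefix u v refl)

drop-prefix : ∀ (u v : Word) {a} → length u ≡ a → drop a (u ++ v) ≡ v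
drop-prefix [] v refl = refl
drop-prefix (x ∷ u) v refl = drop-prefix u v refl

val : Word → ℕ
val [] = 0
val (x ∷ xs) = toℕ x * 4 ^ length xs + val xs

-- val is a bijection from words of length n onto [0, 4^n).
sumWords-val : ∀ n g → sumWords n (λ u → g (val u)) ≡ sumTo (4 ^ n) g
sumWords-val zero g = sym (+-identityʳ (g 0))
sumWords-val (suc n) g = begin
    sumList (λ x → sumWords n (λ u → g (toℕ x * 4 ^ length u + val u))) (allFin 4)
  ≡⟨ sumList-cong (allFin 4) (λ x → trans
       (sumWords-cong n (λ u len → cong (λ l → g (toℕ x * 4 ^ l + val u)) len))
       (sumWords-val n (λ i → g (toℕ x * 4 ^ n + i)))) ⟩
    sumTo 4 (λ c → sumTo (4 ^ n) (λ i → g (c * 4 ^ n + i)))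
  ≡⟨ sym (sumTo-blocks 4 (4 ^ n) g) ⟩
    sumTo (4 ^ suc n) g ∎
  where open ≡-Reasoning

val<4^length : ∀ (xs : Word) → val xs < 4 ^ length xs
val-cons< : ∀ x (xs : Word) → val (x ∷ xs) < suc (toℕ x) * 4 ^ length xs

val<4^length [] = s≤s z≤n
val<4^length (x ∷ xs) = <-≤-trans (val-cons< x xs) (*-monoˡ-≤ (4 ^ length xs) (FinP.toℕ<n x))

val-cons< x xs = begin-strict
    toℕ x * 4 ^ length xs + val xs
  <⟨ +-monoʳ-< (toℕ x * 4 ^ length xs) (val<4^length xs) ⟩
    toℕ x * 4 ^ length xs + 4 ^ length xs
  ≡⟨ +-comm (toℕ x * 4 ^ length xs) (4 ^ length xs) ⟩
    suc (toℕ x) * 4 ^ length xs ∎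
  where open ≤-Reasoning

val-leading< : ∀ x y (xs ys : Word) → length xs ≡ length ys → toℕ x < toℕ y → val (x ∷ xs) < val (y ∷ ys)
val-leading< x y xs ys len x<y = begin-strict
    val (x ∷ xs)
  <⟨ val-cons< x xs ⟩
    suc (toℕ x) * 4 ^ length xs
  ≤⟨ *-monoˡ-≤ (4 ^ length xs) x<y ⟩
    toℕ y * 4 ^ length xs
  ≡⟨ cong (λ l → toℕ y * 4 ^ l) len ⟩
    toℕ y * 4 ^ length ys
  ≤⟨ m≤m+n _ (val ys) ⟩
    val (y ∷ ys) ∎
  where open ≤-Reasoning

val-injective : ∀ (u v : Word) → length u ≡ length v → val u ≡ val v → u ≡ v
val-injective [] [] _ _ = refl
val-injective (x ∷ xs) (y ∷ ys) len eq with <-cmp (toℕ x) (toℕ y)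
... | tri< x<y _ _ = ⊥-elim (<-irrefl eq (val-leading< x y xs ys (suc-injective len) x<y))
... | tri> _ _ y<x = ⊥-elim (<-irrefl (sym eq) (val-leading< y x ys xs (sym (suc-injective len)) y<x))
... | tri≈ _ x≡y _ = cong₂ _∷_ (FinP.toℕ-injective x≡y)
        (val-injective xs ys (suc-injective len) (+-cancelˡ-≡ _ (val xs) (val ys) (trans eq heads)))
  where
  heads : toℕ y * 4 ^ length ys + val ys ≡ toℕ x * 4 ^ length xs + val ys
  heads = cong (_+ val ys) (cong₂ (λ a l → a * 4 ^ l) (sym x≡y) (sym (suc-injective len)))

leading-equal : ∀ (x y : Letter) (xs ys : Word) → (toℕ x <ᵇ toℕ y) ≡ false → (toℕ y <ᵇ toℕ x) ≡ false →
  length xs ≡ length ys → toℕ x * 4 ^ length xs ≡ toℕ y * 4 ^ length ys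
leading-equal x y xs ys x≮y y≮x len = cong₂ (λ a l → a * 4 ^ l) x≡y len
  where
  x≡y : toℕ x ≡ toℕ y
  x≡y = ≤-antisym (≮⇒≥ (λ lt → subst T y≮x (<⇒<ᵇ lt))) (≮⇒≥ (λ lt → subst T x≮y (<⇒<ᵇ lt)))

lexLeq-val : ∀ (u v : Word) → length u ≡ length v →
  if lexLeq u v then val u ≤ val v else val v ≤ val u
lexLeq-val [] [] len = z≤n
lexLeq-val (x ∷ xs) (y ∷ ys) len with toℕ x <ᵇ toℕ y in x<y
... | true = <⇒≤ (val-leading< x y xs ys (suc-injective len) (<ᵇ⇒< _ _ (subst T (sym x<y) _)))
... | false with toℕ y <ᵇ toℕ x in y<x
...   | true = <⇒≤ (val-leading< y x ys xs (sym (suc-injective len)) (<ᵇ⇒< _ _ (subst T (sym y<x) _)))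
...   | false with lexLeq xs ys | lexLeq-val xs ys (suc-injective len)
...     | true  | le = +-mono-≤ (≤-reflexive (leading-equal x y xs ys x<y y<x (suc-injective len))) le
...     | false | le = +-mono-≤ (≤-reflexive (sym (leading-equal x y xs ys x<y y<x (suc-injective len)))) le

lexMin-lower : ∀ (u v : Word) → length u ≡ length v → val (lexMin u v) ≤ val u × val (lexMin u v) ≤ val v
lexMin-lower u v len with lexLeq u v | lexLeq-val u v len
... | true  | u≤v = ≤-refl , u≤v
... | false | v≤u = v≤u , ≤-refl

lexMin-selects : ∀ (u v : Word) → lexMin u v ≡ u ⊎ lexMin u v ≡ v
lexMin-selects u v with lexLeq u v
... | true  = inj₁ refl
... | false = inj₂ refl

window : ℕ → ℕ → Word → Word
window p i u = take p (drop i u)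

windowVal : ℕ → Word → ℕ → ℕ
windowVal p u i = val (window p i u)

length-window : ∀ p i (u : Word) → i + p ≤ length u → length (window p i u) ≡ p
length-window p i u fits = trans (LP.length-take p (drop i u)) (m≤n⇒m⊓n≡m (begin
    p                 ≤⟨ m+n≤o⇒m≤o∸n p (subst (_≤ length u) (+-comm i p) fits) ⟩
    length u ∸ i      ≡⟨ sym (LP.length-drop i u) ⟩
    length (drop i u) ∎))
  where open ≤-Reasoning

window-take : ∀ p i k (w : Word) → i + p ≤ k → window p i (take k w) ≡ window p i w
window-take p i k w fits = begin
    take p (drop i (take k w))
  ≡⟨ LP.take-drop p i (take k w) ⟩
    drop i (take (i + p) (take k w))
  ≡⟨ cong (drop i) (trans (LP.take-take (i + p) k w) (cong (λ n → take n w) (m≤n⇒m⊓n≡m fits))) ⟩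
    drop i (take (i + p) w)
  ≡⟨ sym (LP.take-drop p i w) ⟩
    take p (drop i w) ∎
  where open ≡-Reasoning

windows-cons : ∀ p x (xs : Word) → p ≤ length (x ∷ xs) → windows p (x ∷ xs) ≡ take p (x ∷ xs) ∷ windows p xs
windows-cons p x xs fits with p ≤ᵇ length (x ∷ xs) | ≤⇒≤ᵇ fits
... | true | _ = refl

windows-short : ∀ p (u : Word) → length u < p → windows p u ≡ []
windows-short p [] short = refl
windows-short p (x ∷ xs) short with p ≤ᵇ length (x ∷ xs) in fits
... | true  = ⊥-elim (<⇒≱ short (≤ᵇ⇒≤ p _ (subst T (sym fits) _)))
... | false = refl

windows-complete : ∀ p i (u : Word) → 1 ≤ p → i + p ≤ length u → window p i u ∈ windows p u
windows-complete p i [] p≥1 fits = ⊥-elim (<⇒≱ (≤-trans p≥1 (m≤n+m p i)) fits)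
windows-complete p i (x ∷ xs) p≥1 fits rewrite windows-cons p x xs (m+n≤o⇒n≤o i fits) with i
... | zero  = here refl
... | suc i = there (windows-complete p i xs p≥1 (≤-pred fits))

windows-sound : ∀ p (u : Word) y → y ∈ windows p u → ∃ λ i → i + p ≤ length u × y ≡ window p i u
windows-sound p [] y ()
windows-sound p (x ∷ xs) y y∈ with p ≤ᵇ length (x ∷ xs) in fits | y∈
... | true | here refl = 0 , ≤ᵇ⇒≤ p _ (subst T (sym fits) _) , refl
... | true | there y∈xs with windows-sound p xs y y∈xs
...   | i , i+p≤ , eq = suc i , s≤s i+p≤ , eq

foldr-lexMin-selects : ∀ (a : Word) xs → foldr lexMin a xs ≡ a ⊎ foldr lexMin a xs ∈ xs
foldr-lexMin-selects a [] = inj₁ refl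
foldr-lexMin-selects a (x ∷ xs) with lexMin-selects x (foldr lexMin a xs)
... | inj₁ eq = inj₂ (here eq)
... | inj₂ eq with foldr-lexMin-selects a xs
...   | inj₁ eq′ = inj₁ (trans eq eq′)
...   | inj₂ r∈ = inj₂ (there (subst (_∈ xs) (sym eq) r∈))

foldr-lexMin-length : ∀ p (a : Word) xs → length a ≡ p → (∀ y → y ∈ xs → length y ≡ p) →
  length (foldr lexMin a xs) ≡ p
foldr-lexMin-length p a xs len-a len-xs with foldr-lexMin-selects a xs
... | inj₁ eq = trans (cong length eq) len-a
... | inj₂ r∈ = len-xs _ r∈

foldr-lexMin-least : ∀ p (a : Word) xs → length a ≡ p → (∀ y → y ∈ xs → length y ≡ p) →
  ∀ y → y ∈ xs → val (foldr lexMin a xs) ≤ val y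
foldr-lexMin-least p a (x ∷ xs) len-a len-xs = least
  where
  r = foldr lexMin a xs
  len-xs′ : ∀ y → y ∈ xs → length y ≡ p
  len-xs′ y y∈ = len-xs y (there y∈)
  bounds : val (lexMin x r) ≤ val x × val (lexMin x r) ≤ val r
  bounds = lexMin-lower x r (trans (len-xs x (here refl)) (sym (foldr-lexMin-length p a xs len-a len-xs′)))
  least : ∀ y → y ∈ x ∷ xs → val (lexMin x r) ≤ val y
  least y (here refl)  = proj₁ bounds
  least y (there y∈xs) = ≤-trans (proj₂ bounds) (foldr-lexMin-least p a xs len-a len-xs′ y y∈xs)

IsMinOn : (ℕ → ℕ) → ℕ → ℕ → Set
IsMinOn f n μ = (∀ i → i ≤ n → μ ≤ f i) × ∃ λ i → i ≤ n × μ ≡ f i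

IsMinOn-cong : ∀ {f g} n {μ} → (∀ i → i ≤ n → f i ≡ g i) → IsMinOn f n μ → IsMinOn g n μ
IsMinOn-cong n eq (least , i , i≤n , μ≡) =
  (λ j j≤n → subst (_ ≤_) (eq j j≤n) (least j j≤n)) , i , i≤n , trans μ≡ (eq i i≤n)

windows-length : ∀ p (u : Word) y → y ∈ windows p u → length y ≡ p
windows-length p u y y∈ with windows-sound p u y y∈
... | i , i+p≤ , refl = length-window p i u i+p≤

minP-isMin : ∀ n p (u : Word) → 1 ≤ p → length u ≡ n + p → IsMinOn (windowVal p u) n (val (minP p u))
minP-isMin n p u p≥1 len = least , attained
  where
  fits : ∀ {i} → i ≤ n → i + p ≤ length u
  fits i≤n = subst (_ + p ≤_) (sym len) (+-monoˡ-≤ p i≤n)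
  inRange : ∀ {i} → i + p ≤ length u → i ≤ n
  inRange i+p≤ = +-cancelʳ-≤ p _ n (subst (_ + p ≤_) len i+p≤)
  least : ∀ i → i ≤ n → val (minP p u) ≤ windowVal p u i
  least i i≤n = foldr-lexMin-least p (take p u) (windows p u) (length-window p 0 u (fits z≤n)) (windows-length p u)
                  (window p i u) (windows-complete p i u p≥1 (fits i≤n))
  attained : ∃ λ i → i ≤ n × val (minP p u) ≡ windowVal p u i
  attained with foldr-lexMin-selects (take p u) (windows p u)
  ... | inj₁ eq = 0 , z≤n , cong val eq
  ... | inj₂ m∈ with windows-sound p u (minP p u) m∈
  ...   | i , i+p≤ , eq = i , inRange i+p≤ , cong val eq

length-minP : ∀ n p (u : Word) → length u ≡ n + p → length (minP p u) ≡ p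
length-minP n p u len = foldr-lexMin-length p (take p u) (windows p u)
  (length-window p 0 u (subst (p ≤_) (sym len) (m≤n+m p n))) (windows-length p u)

slidingMin-stable : ∀ (f : ℕ → ℕ) n {μ₁ μ₂} → IsMinOn f n μ₁ → IsMinOn (λ i → f (suc i)) n μ₂ →
  (∃ λ j → j ≤ n × f (suc j) ≤ f 0) → (∃ λ j → j ≤ n × f j ≤ f (suc n)) → μ₁ ≡ μ₂
slidingMin-stable f n {μ₁} {μ₂} (least₁ , i₁ , i₁≤n , μ₁≡) (least₂ , i₂ , i₂≤n , μ₂≡)
                  (j , j≤n , f0-beaten) (j′ , j′≤n , fn-beaten) = ≤-antisym μ₁≤μ₂ μ₂≤μ₁
  where
  μ₁≤μ₂ : μ₁ ≤ μ₂
  μ₁≤μ₂ with m≤n⇒m<n∨m≡n i₂≤n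
  ... | inj₁ i₂<n = ≤-trans (least₁ (suc i₂) i₂<n) (≤-reflexive (sym μ₂≡))
  ... | inj₂ refl = ≤-trans (least₁ j′ j′≤n) (≤-trans fn-beaten (≤-reflexive (sym μ₂≡)))
  μ₂≤μ₁ : μ₂ ≤ μ₁
  μ₂≤μ₁ = attainedAt i₁ i₁≤n μ₁≡
    where
    attainedAt : ∀ i → i ≤ n → μ₁ ≡ f i → μ₂ ≤ μ₁
    attainedAt zero    _    eq = ≤-trans (least₂ j j≤n) (≤-trans f0-beaten (≤-reflexive (sym eq)))
    attainedAt (suc i) si≤n eq = ≤-trans (least₂ i (<⇒≤ si≤n)) (≤-reflexive (sym eq))

differ : Word → Word → ℕ
differ u v with LP.≡-dec Fin._≟_ u v
... | yes _ = 0
... | no _  = 1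

differ-≡ : ∀ {u v} → u ≡ v → differ u v ≡ 0
differ-≡ {u} {v} u≡v with LP.≡-dec Fin._≟_ u v
... | yes _  = refl
... | no u≢v = ⊥-elim (u≢v u≡v)

differ-≢ : ∀ {u v} → ¬ u ≡ v → differ u v ≡ 1
differ-≢ {u} {v} u≢v with LP.≡-dec Fin._≟_ u v
... | yes u≡v = ⊥-elim (u≢v u≡v)
... | no _    = refl

differ≤1 : ∀ u v → differ u v ≤ 1
differ≤1 u v with LP.≡-dec Fin._≟_ u v
... | yes _ = z≤n
... | no _  = ≤-refl

minChange : ℕ → ℕ → Word → ℕ
minChange k p w = differ (minP p (take k w)) (minP p (drop 1 w))

exceeds : ℕ → ℕ → ℕ
exceeds r zero = 0
exceeds zero (suc x) = 1
exceeds (suc r) (suc x) = exceeds r x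

exceeds-zero : ∀ r x → exceeds r x ≡ 0 → x ≤ r
exceeds-zero r zero _ = z≤n
exceeds-zero (suc r) (suc x) eq = s≤s (exceeds-zero r x eq)

blocksExceed : ℕ → ℕ → ℕ → Word → ℕ
blocksExceed p r zero v = 1
blocksExceed p r (suc q) v = exceeds r (val (take p v)) * blocksExceed p r q (drop p v)

blocksExceed-zero : ∀ p r q (v : Word) → blocksExceed p r q v ≡ 0 → ∃ λ j → j < q × windowVal p v (j * p) ≤ r
blocksExceed-zero p r (suc q) v eq with m*n≡0⇒m≡0∨n≡0 (exceeds r (val (take p v))) eq
... | inj₁ first = 0 , s≤s z≤n , exceeds-zero r _ first
... | inj₂ rest with blocksExceed-zero p r q (drop p v) rest
...   | j , j<q , low = suc j , s≤s j<q , subst (λ u → val (take p u) ≤ r) (LP.drop-drop p (j * p) v) low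

leadingStrictMin : ℕ → ℕ → Word → ℕ
leadingStrictMin p q w = blocksExceed p (windowVal p w 0) q (drop p w)

trailingStrictMin : ℕ → ℕ → ℕ → Word → ℕ
trailingStrictMin p q t w = blocksExceed p (windowVal p w (t + q * p)) q (drop t w)

block-fits : ∀ p q j → j < q → p + j * p ≤ q * p
block-fits p q j j<q = *-monoˡ-≤ p j<q

minChange-covered : ∀ n p q t (w : Word) → 1 ≤ p → t + q * p ≡ suc n → length w ≡ suc (n + p) →
  minChange (n + p) p w ≤ leadingStrictMin p q w + trailingStrictMin p q t w
minChange-covered n (suc p′) q t (x ∷ xs) p≥1 split len
  with leadingStrictMin (suc p′) q (x ∷ xs) in lead | trailingStrictMin (suc p′) q t (x ∷ xs) in trail
... | suc _ | _     = ≤-trans (differ≤1 _ _) (s≤s z≤n)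
... | zero  | suc _ = ≤-trans (differ≤1 _ _) (s≤s z≤n)
... | zero  | zero  = ≤-reflexive (differ-≡ (val-injective _ _ equal-lengths equal-minima))
  where
  p = suc p′
  w = x ∷ xs
  k = n + p
  len-take : length (take k w) ≡ n + p
  len-take = trans (LP.length-take k w) (m≤n⇒m⊓n≡m (subst (k ≤_) (sym len) (n≤1+n k)))
  equal-lengths : length (minP p (take k w)) ≡ length (minP p xs)
  equal-lengths = trans (length-minP n p (take k w) len-take) (sym (length-minP n p xs (suc-injective len)))
  first-kmer : IsMinOn (windowVal p w) n (val (minP p (take k w)))
  first-kmer = IsMinOn-cong n (λ i i≤n → cong val (window-take p i k w (+-monoˡ-≤ p i≤n)))
                 (minP-isMin n p (take k w) p≥1 len-take)
  -- Block j < q sits at position p + j·p = 1 + (p′ + j·p), resp. t + j·p, inside 0 … n + 1.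
  leading-index : ∀ {j} → j < q → p′ + j * p ≤ n
  leading-index j<q = ≤-pred (≤-trans (block-fits p q _ j<q) (≤-trans (m≤n+m (q * p) t) (≤-reflexive split)))
  trailing-index : ∀ {j} → j < q → t + j * p ≤ n
  trailing-index {j} j<q = ≤-pred (begin
    suc (t + j * p)  ≡⟨ sym (+-suc t (j * p)) ⟩
    t + suc (j * p)  ≤⟨ +-monoʳ-≤ t (+-monoˡ-≤ (j * p) p≥1) ⟩
    t + (p + j * p)  ≤⟨ +-monoʳ-≤ t (block-fits p q j j<q) ⟩
    t + q * p        ≡⟨ split ⟩
    suc n            ∎)
    where open ≤-Reasoning
  leading-beaten : ∃ λ j → j ≤ n × windowVal p w (suc j) ≤ windowVal p w 0
  leading-beaten with blocksExceed-zero p (windowVal p w 0) q (drop p w) lead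
  ... | j , j<q , low = p′ + j * p , leading-index j<q ,
        subst (λ u → val (take p u) ≤ windowVal p w 0) (LP.drop-drop p (j * p) w) low
  trailing-beaten : ∃ λ j → j ≤ n × windowVal p w j ≤ windowVal p w (suc n)
  trailing-beaten with blocksExceed-zero p (windowVal p w (t + q * p)) q (drop t w) trail
  ... | j , j<q , low = t + j * p , trailing-index j<q ,
        subst₂ (λ u i → val (take p u) ≤ windowVal p w i) (LP.drop-drop t (j * p) w) split low
  equal-minima : val (minP p (take k w)) ≡ val (minP p xs)
  equal-minima = slidingMin-stable (windowVal p w) n first-kmer
                   (minP-isMin n p xs p≥1 (suc-injective len)) leading-beaten trailing-beaten

blocksExceed-prefix : ∀ p r q (v y : Word) → length v ≡ q * p → blocksExceed p r q (v ++ y) ≡ blocksExceed p r q v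
blocksExceed-prefix p r zero v y len = refl
blocksExceed-prefix p r (suc q) v y len = cong₂ (λ a b → exceeds r (val a) * b)
  (take-++ p v y p≤)
  (trans (cong (blocksExceed p r q) (drop-++ p v y p≤)) (blocksExceed-prefix p r q (drop p v) y len′))
  where
  p≤ : p ≤ length v
  p≤ = subst (p ≤_) (sym len) (m≤m+n p (q * p))
  len′ : length (drop p v) ≡ q * p
  len′ = trans (LP.length-drop p v) (trans (cong (_∸ p) len) (m+n∸m≡n p (q * p)))

sumTo-exceeds : ∀ P r → sumTo P (exceeds r) ≡ P ∸ suc r
sumTo-exceeds zero r = refl
sumTo-exceeds (suc P) zero = sumTo-ones P
  where
  sumTo-ones : ∀ P → sumTo P (λ _ → 1) ≡ P
  sumTo-ones zero = refl
  sumTo-ones (suc P) = cong suc (sumTo-ones P)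
sumTo-exceeds (suc P) (suc r) = sumTo-exceeds P r

blocksExceed-count : ∀ p q r → sumWords (q * p) (blocksExceed p r q) ≡ (4 ^ p ∸ suc r) ^ q
blocksExceed-count p zero r = refl
blocksExceed-count p (suc q) r = begin
    sumWords (p + q * p) (blocksExceed p r (suc q))
  ≡⟨ sumWords-split p (q * p) _ ⟩
    sumWords p (λ u → sumWords (q * p) (λ v → blocksExceed p r (suc q) (u ++ v)))
  ≡⟨ sumWords-cong p (λ u len → trans
       (sumWords-cong (q * p) (λ v _ → cong₂ (λ a b → exceeds r (val a) * blocksExceed p r q b)
                                               (take-prefix u v len) (drop-prefix u v len)))
       (trans (sumWords-*ˡ (q * p) (exceeds r (val u)) (blocksExceed p r q))
              (cong (exceeds r (val u) *_) (blocksExceed-count p q r)))) ⟩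
    sumWords p (λ u → exceeds r (val u) * (4 ^ p ∸ suc r) ^ q)
  ≡⟨ sumWords-*ʳ p _ (λ u → exceeds r (val u)) ⟩
    sumWords p (λ u → exceeds r (val u)) * (4 ^ p ∸ suc r) ^ q
  ≡⟨ cong (_* (4 ^ p ∸ suc r) ^ q) (trans (sumWords-val p (exceeds r)) (sumTo-exceeds (4 ^ p) r)) ⟩
    (4 ^ p ∸ suc r) * (4 ^ p ∸ suc r) ^ q ∎
  where open ≡-Reasoning

-- The first two terms of the binomial expansion of (P + 1)^(q+1).
binomial-lower : ∀ P q → P ^ suc q + suc q * P ^ q ≤ suc P ^ suc q
binomial-lower P zero = ≤-reflexive (lemma P)
  where
  lemma : ∀ P → P * 1 + 1 * 1 ≡ (1 + P) * 1
  lemma = solve-∀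
binomial-lower P (suc q) = begin
    P * (P * P ^ q) + suc (suc q) * (P * P ^ q)
  ≤⟨ m≤m+n _ (suc q * P ^ q) ⟩
    P * (P * P ^ q) + suc (suc q) * (P * P ^ q) + suc q * P ^ q
  ≡⟨ lemma P (P ^ q) q ⟩
    suc P * (P ^ suc q + suc q * P ^ q)
  ≤⟨ *-monoʳ-≤ (suc P) (binomial-lower P q) ⟩
    suc P * suc P ^ suc q ∎
  where
  open ≤-Reasoning
  lemma : ∀ P a q → P * (P * a) + (2 + q) * (P * a) + (1 + q) * a ≡ (1 + P) * (P * a + (1 + q) * a)
  lemma = solve-∀

powerSum-bound : ∀ q P → suc q * sumTo P (λ r → (P ∸ suc r) ^ q) ≤ P ^ suc q
powerSum-bound q zero = ≤-reflexive (*-zeroʳ (suc q))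
powerSum-bound q (suc P) = begin
    suc q * (P ^ q + sumTo P (λ r → (P ∸ suc r) ^ q))
  ≡⟨ *-distribˡ-+ (suc q) (P ^ q) _ ⟩
    suc q * P ^ q + suc q * sumTo P (λ r → (P ∸ suc r) ^ q)
  ≤⟨ +-monoʳ-≤ (suc q * P ^ q) (powerSum-bound q P) ⟩
    suc q * P ^ q + P ^ suc q
  ≡⟨ +-comm (suc q * P ^ q) (P ^ suc q) ⟩
    P ^ suc q + suc q * P ^ q
  ≤⟨ binomial-lower P q ⟩
    suc P ^ suc q ∎
  where open ≤-Reasoning

strictMinCount : ℕ → ℕ → ℕ
strictMinCount p q = sumWords p (λ z → sumWords (q * p) (blocksExceed p (val z) q))

strictMinCount-bound : ∀ p q → suc q * strictMinCount p q ≤ 4 ^ (p * suc q)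
strictMinCount-bound p q = begin
    suc q * strictMinCount p q
  ≡⟨ cong (suc q *_) (sumWords-cong p (λ z _ → blocksExceed-count p q (val z))) ⟩
    suc q * sumWords p (λ z → (4 ^ p ∸ suc (val z)) ^ q)
  ≡⟨ cong (suc q *_) (sumWords-val p (λ r → (4 ^ p ∸ suc r) ^ q)) ⟩
    suc q * sumTo (4 ^ p) (λ r → (4 ^ p ∸ suc r) ^ q)
  ≤⟨ powerSum-bound q (4 ^ p) ⟩
    (4 ^ p) ^ suc q
  ≡⟨ ^-*-assoc 4 p (suc q) ⟩
    4 ^ (p * suc q) ∎
  where open ≤-Reasoning

leadingStrictMin-count : ∀ p q t → sumWords (p + (q * p + t)) (leadingStrictMin p q) ≡ 4 ^ t * strictMinCount p q
leadingStrictMin-count p q t = begin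
    sumWords (p + (q * p + t)) (leadingStrictMin p q)
  ≡⟨ sumWords-split p (q * p + t) (leadingStrictMin p q) ⟩
    sumWords p (λ z → sumWords (q * p + t) (λ v → leadingStrictMin p q (z ++ v)))
  ≡⟨ sumWords-cong p (λ z len → trans
       (sumWords-cong (q * p + t) (λ v _ → cong₂ (λ a b → blocksExceed p (val a) q b)
                                                 (take-prefix z v len) (drop-prefix z v len)))
       (sumWords-prefix (q * p) t _ (blocksExceed p (val z) q) (blocksExceed-prefix p (val z) q))) ⟩
    sumWords p (λ z → 4 ^ t * sumWords (q * p) (blocksExceed p (val z) q))
  ≡⟨ sumWords-*ˡ p (4 ^ t) _ ⟩
    4 ^ t * strictMinCount p q ∎
  where open ≡-Reasoning

trailingStrictMin-count : ∀ p q t → sumWords (t + (q * p + p)) (trailingStrictMin p q t) ≡ 4 ^ t * strictMinCount p q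
trailingStrictMin-count p q t = begin
    sumWords (t + (q * p + p)) (trailingStrictMin p q t)
  ≡⟨ sumWords-suffix t (q * p + p) (trailingStrictMin p q t) lastStrictMin ignore-first-t ⟩
    4 ^ t * sumWords (q * p + p) lastStrictMin
  ≡⟨ cong (4 ^ t *_) (sumWords-split (q * p) p lastStrictMin) ⟩
    4 ^ t * sumWords (q * p) (λ v → sumWords p (λ z → lastStrictMin (v ++ z)))
  ≡⟨ cong (4 ^ t *_) (sumWords-cong (q * p) (λ v len → sumWords-cong p (λ z len′ → blocks-then-last v z len len′))) ⟩
    4 ^ t * sumWords (q * p) (λ v → sumWords p (λ z → blocksExceed p (val z) q v))
  ≡⟨ cong (4 ^ t *_) (sumWords-swap (q * p) p (λ v z → blocksExceed p (val z) q v)) ⟩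
    4 ^ t * strictMinCount p q ∎
  where
  open ≡-Reasoning
  lastStrictMin : Word → ℕ
  lastStrictMin u = blocksExceed p (windowVal p u (q * p)) q u
  ignore-first-t : ∀ x u → length x ≡ t → trailingStrictMin p q t (x ++ u) ≡ lastStrictMin u
  ignore-first-t x u len = cong₂ (λ a b → blocksExceed p (val (take p a)) q b)
    (trans (sym (LP.drop-drop t (q * p) (x ++ u))) (cong (drop (q * p)) (drop-prefix x u len)))
    (drop-prefix x u len)
  blocks-then-last : ∀ v z → length v ≡ q * p → length z ≡ p → lastStrictMin (v ++ z) ≡ blocksExceed p (val z) q v
  blocks-then-last v z len len′ = trans
    (cong (λ a → blocksExceed p (val a) q (v ++ z))
          (trans (cong (take p) (drop-prefix v z len)) (LP.take-all p z (≤-reflexive len′))))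
    (blocksExceed-prefix p (val z) q v z len)

minChange-count : ∀ n p q t → 1 ≤ p → t + q * p ≡ suc n →
  suc q * sumWords (suc (n + p)) (minChange (n + p) p) ≤ 2 * 4 ^ suc (n + p)
minChange-count n p q t p≥1 split = begin
    suc q * sumWords (suc k) (minChange k p)
  ≤⟨ *-monoʳ-≤ (suc q) (sumWords-mono (suc k) (λ w len → minChange-covered n p q t w p≥1 split len)) ⟩
    suc q * sumWords (suc k) (λ w → leadingStrictMin p q w + trailingStrictMin p q t w)
  ≡⟨ cong (suc q *_) (sumWords-+ (suc k) (leadingStrictMin p q) (trailingStrictMin p q t)) ⟩
    suc q * (sumWords (suc k) (leadingStrictMin p q) + sumWords (suc k) (trailingStrictMin p q t))
  ≡⟨ cong (λ x → suc q * x) (cong₂ _+_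
       (subst (λ L → sumWords L (leadingStrictMin p q) ≡ 4 ^ t * M) leading-length (leadingStrictMin-count p q t))
       (subst (λ L → sumWords L (trailingStrictMin p q t) ≡ 4 ^ t * M) trailing-length (trailingStrictMin-count p q t))) ⟩
    suc q * (4 ^ t * M + 4 ^ t * M)
  ≡⟨ distribute (suc q) (4 ^ t) M ⟩
    2 * (4 ^ t * (suc q * M))
  ≤⟨ *-monoʳ-≤ 2 (*-monoʳ-≤ (4 ^ t) (strictMinCount-bound p q)) ⟩
    2 * (4 ^ t * 4 ^ (p * suc q))
  ≡⟨ cong (2 *_) (trans (sym (^-distribˡ-+-* 4 t (p * suc q))) (cong (4 ^_) (trans (exponent t p q) leading-length))) ⟩
    2 * 4 ^ suc k ∎
  where
  open ≤-Reasoning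
  k = n + p
  M = strictMinCount p q
  leading-length : p + (q * p + t) ≡ suc k
  leading-length = trans (cong (p +_) (trans (+-comm (q * p) t) split)) (trans (+-suc p n) (cong suc (+-comm p n)))
  trailing-length : t + (q * p + p) ≡ suc k
  trailing-length = trans (sym (+-assoc t (q * p) p)) (cong (_+ p) split)
  distribute : ∀ a b c → a * (b * c + b * c) ≡ 2 * (b * (a * c))
  distribute = solve-∀
  exponent : ∀ t p q → t + p * (1 + q) ≡ p + (q * p + t)
  exponent = solve-∀

-- Between consecutive k-mers of a uniformly random (k+1)-mer, min_p changes with probability
-- at most 4p/k (here k = n + p): take q = ⌊(n+1)/p⌋ and t = (n+1) mod p, so that k ≤ 2p(q+1).
minChange-density : ∀ n p → 1 ≤ p → (n + p) * sumWords (suc (n + p)) (minChange (n + p) p) ≤ 4 * p * 4 ^ suc (n + p)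
minChange-density n (suc p′) p≥1 = begin
    k * S
  ≤⟨ *-monoˡ-≤ S k≤ ⟩
    2 * p * suc q * S
  ≡⟨ *-assoc (2 * p) (suc q) S ⟩
    2 * p * (suc q * S)
  ≤⟨ *-monoʳ-≤ (2 * p) (minChange-count n p q t p≥1 split) ⟩
    2 * p * (2 * 4 ^ suc k)
  ≡⟨ reassoc p (4 ^ suc k) ⟩
    4 * p * 4 ^ suc k ∎
  where
  open ≤-Reasoning
  p = suc p′
  k = n + p
  q = suc n / p
  t = suc n % p
  split : t + q * p ≡ suc n
  split = sym (m≡m%n+[m/n]*n (suc n) p)
  S = sumWords (suc k) (minChange k p)
  k≤ : k ≤ 2 * p * suc q
  k≤ = begin
      n + p                     ≤⟨ +-monoˡ-≤ p (n≤1+n n) ⟩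
      suc n + p                 ≡⟨ cong (_+ p) (sym split) ⟩
      t + q * p + p             ≤⟨ +-monoˡ-≤ p (+-monoˡ-≤ (q * p) (<⇒≤ (m%n<n (suc n) p))) ⟩
      p + q * p + p             ≤⟨ m≤m+n _ (q * p) ⟩
      p + q * p + p + q * p     ≡⟨ collect p q ⟩
      2 * p * suc q             ∎
    where
    collect : ∀ p q → p + q * p + p + q * p ≡ 2 * p * (1 + q)
    collect = solve-∀
  reassoc : ∀ p a → 2 * p * (2 * a) ≡ 4 * p * a
  reassoc = solve-∀

changes : List Word → ℕ
changes [] = 0
changes (x ∷ []) = 0
changes (x ∷ y ∷ xs) = differ x y + changes (y ∷ xs)

-- Lengths of the maximal runs: len + |xs| entries in total, and one more run per change.
runsGo-lengths : ∀ k i cur st len xs →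
  sumList (λ run → proj₂ run + k) (runsGo i cur st len xs) ≡ len + length xs + k + k * changes (cur ∷ xs)
runsGo-lengths k i cur st len [] = single-run len k
  where
  single-run : ∀ a k → a + k + 0 ≡ a + 0 + k + k * 0
  single-run = solve-∀
runsGo-lengths k i cur st len (x ∷ xs) with LP.≡-dec Fin._≟_ x cur
... | yes refl rewrite differ-≡ {x} refl | +-suc len (length xs) = runsGo-lengths k (suc i) x st (suc len) xs
... | no x≢cur rewrite differ-≢ (λ cur≡x → x≢cur (sym cur≡x)) =
  trans (cong (len + k +_) (runsGo-lengths k (suc i) x i 1 xs)) (one-more-run len (length xs) k (changes (x ∷ xs)))
  where
  one-more-run : ∀ a l k c → a + k + (1 + l + k + k * c) ≡ a + suc l + k + k * (1 + c)
  one-more-run = solve-∀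

-- A run of r equal entries yields a super k-mer of length at most r + k.
partitionSize-runs : ∀ k p (s : Word) → let M = map (minP p) (kmers k s) in
  partitionSize k p s ≤ length M + k + k * changes M
partitionSize-runs k p s = begin
    sum (map length (superKmers k p s))
  ≡⟨ sumList-map length _ (runs M) ⟩
    sumList (λ { (i , r) → length (take (r + k ∸ 1) (drop i s)) }) (runs M)
  ≤⟨ sumList-mono (runs M) (λ { (i , r) → ≤-trans (≤-reflexive (LP.length-take (r + k ∸ 1) (drop i s)))
                                             (≤-trans (m⊓n≤m (r + k ∸ 1) _) (m∸n≤m (r + k) 1)) }) ⟩
    sumList (λ run → proj₂ run + k) (runs M)
  ≤⟨ all-runs M ⟩
    length M + k + k * changes M ∎
  where
  open ≤-Reasoning
  M = map (minP p) (kmers k s)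
  all-runs : ∀ M → sumList (λ run → proj₂ run + k) (runs M) ≤ length M + k + k * changes M
  all-runs [] = z≤n
  all-runs (x ∷ xs) = ≤-reflexive (runsGo-lengths k 1 x 0 1 xs)

-- Consecutive k-windows of s are the two k-mers of a (k+1)-window of s.
changes-windows : ∀ k (f : Word → Word) (s : Word) → 1 ≤ k →
  changes (map f (windows k s)) ≡ sumList (λ w → differ (f (take k w)) (f (drop 1 w))) (windows (suc k) s)
changes-windows k f [] k≥1 = refl
changes-windows k f (x ∷ xs) k≥1 with k ≤? length xs
changes-windows k f (x ∷ []) k≥1 | yes k≤0 = ⊥-elim (<⇒≱ k≥1 k≤0)
changes-windows k f (x ∷ y ∷ ys) k≥1 | yes k≤ = begin
    changes (map f (windows k (x ∷ y ∷ ys)))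
  ≡⟨ cong (λ ws → changes (map f ws)) (windows-cons k x (y ∷ ys) (m≤n⇒m≤1+n k≤)) ⟩
    changes (f (take k (x ∷ y ∷ ys)) ∷ map f (windows k (y ∷ ys)))
  ≡⟨ cong (λ ws → changes (f (take k (x ∷ y ∷ ys)) ∷ map f ws)) (windows-cons k y ys k≤) ⟩
    differ (f (take k (x ∷ y ∷ ys))) (f (take k (y ∷ ys))) + changes (map f (take k (y ∷ ys) ∷ windows k ys))
  ≡⟨ cong₂ _+_ (cong (λ u → differ (f u) (f (take k (y ∷ ys)))) (sym first-kmer))
               (trans (cong (λ ws → changes (map f ws)) (sym (windows-cons k y ys k≤)))
                      (changes-windows k f (y ∷ ys) k≥1)) ⟩
    differ (f (take k (take (suc k) (x ∷ y ∷ ys)))) (f (take k (y ∷ ys))) + sumList g (windows (suc k) (y ∷ ys))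
  ≡⟨ cong (sumList g) (sym (windows-cons (suc k) x (y ∷ ys) (s≤s k≤))) ⟩
    sumList g (windows (suc k) (x ∷ y ∷ ys)) ∎
  where
  open ≡-Reasoning
  g : Word → ℕ
  g w = differ (f (take k w)) (f (drop 1 w))
  first-kmer : take k (take (suc k) (x ∷ y ∷ ys)) ≡ take k (x ∷ y ∷ ys)
  first-kmer = trans (LP.take-take k (suc k) (x ∷ y ∷ ys))
                     (cong (λ n → take n (x ∷ y ∷ ys)) (m≤n⇒m⊓n≡m (n≤1+n k)))
changes-windows k f (x ∷ xs) k≥1 | no k≰
  rewrite windows-short (suc k) (x ∷ xs) (s≤s (≰⇒> k≰)) | windows-short k xs (≰⇒> k≰)
  with k ≤ᵇ length (x ∷ xs)
... | true  = refl
... | false = refl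

partitionSize-bound : ∀ k p (s : Word) → 1 ≤ k →
  partitionSize k p s ≤ length s + k + k * sumList (minChange k p) (windows (suc k) s)
partitionSize-bound k p s k≥1 = begin
    partitionSize k p s
  ≤⟨ partitionSize-runs k p s ⟩
    length M + k + k * changes M
  ≤⟨ +-monoˡ-≤ _ (+-monoˡ-≤ k (≤-trans (≤-reflexive (LP.length-map (minP p) (windows k s)))
                                      (length-windows k s))) ⟩
    length s + k + k * changes M
  ≡⟨ cong (λ c → length s + k + k * c) (changes-windows k (minP p) s k≥1) ⟩
    length s + k + k * sumList (minChange k p) (windows (suc k) s) ∎
  where
  open ≤-Reasoning
  M = map (minP p) (kmers k s)
  length-windows : ∀ k (s : Word) → length (windows k s) ≤ length s
  length-windows k [] = z≤n
  length-windows k (x ∷ xs) with k ≤ᵇ length (x ∷ xs)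
  ... | true  = s≤s (length-windows k xs)
  ... | false = z≤n

windowSum : ℕ → (Word → ℕ) → Word → ℕ
windowSum L h s = sumList h (windows L s)

windowSum-cons : ∀ L h x (xs : Word) → L ≤ length (x ∷ xs) →
  windowSum L h (x ∷ xs) ≡ h (take L (x ∷ xs)) + windowSum L h xs
windowSum-cons L h x xs fits = cong (sumList h) (windows-cons L x xs fits)

-- A word of length j + L has j + 1 windows of length L, each uniformly distributed.
windowSum-exact : ∀ L h j → 1 ≤ L → sumWords (j + L) (windowSum L h) ≡ suc j * 4 ^ j * sumWords L h
windowSum-exact L h zero L≥1 = trans (sumWords-cong L single-window) (sym (+-identityʳ (sumWords L h)))
  where
  single-window : ∀ s → length s ≡ L → windowSum L h s ≡ h s
  single-window [] len = ⊥-elim (<⇒≱ L≥1 (≤-reflexive (sym len)))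
  single-window (x ∷ xs) len = begin
      windowSum L h (x ∷ xs)
    ≡⟨ windowSum-cons L h x xs (≤-reflexive (sym len)) ⟩
      h (take L (x ∷ xs)) + windowSum L h xs
    ≡⟨ cong₂ _+_ (cong h (LP.take-all L (x ∷ xs) (≤-reflexive len)))
                 (cong (sumList h) (windows-short L xs (subst (length xs <_) len ≤-refl))) ⟩
      h (x ∷ xs) + 0
    ≡⟨ +-identityʳ (h (x ∷ xs)) ⟩
      h (x ∷ xs) ∎
    where open ≡-Reasoning
windowSum-exact L h (suc j) L≥1 = begin
    sumWords (suc (j + L)) (windowSum L h)
  ≡⟨ sumWords-cong (suc (j + L)) first-and-rest ⟩
    sumWords (suc (j + L)) (λ s → h (take L s) + windowSum L h (drop 1 s))
  ≡⟨ sumWords-+ (suc (j + L)) (λ s → h (take L s)) (λ s → windowSum L h (drop 1 s)) ⟩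
    sumWords (suc j + L) (λ s → h (take L s)) + sumWords (1 + (j + L)) (λ s → windowSum L h (drop 1 s))
  ≡⟨ cong₂ _+_ first-window other-windows ⟩
    4 ^ suc j * sumWords L h + 4 ^ 1 * (suc j * 4 ^ j * sumWords L h)
  ≡⟨ collect (4 ^ j) j (sumWords L h) ⟩
    suc (suc j) * 4 ^ suc j * sumWords L h ∎
  where
  open ≡-Reasoning
  first-and-rest : ∀ s → length s ≡ suc (j + L) → windowSum L h s ≡ h (take L s) + windowSum L h (drop 1 s)
  first-and-rest (x ∷ xs) len = windowSum-cons L h x xs (subst (L ≤_) (sym len) (≤-trans (m≤n+m L j) (n≤1+n _)))
  first-window : sumWords (suc j + L) (λ s → h (take L s)) ≡ 4 ^ suc j * sumWords L h
  first-window = trans (cong (λ n → sumWords n (λ s → h (take L s))) (+-comm (suc j) L))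
                       (sumWords-prefix L (suc j) (λ s → h (take L s)) h (λ u v len → cong h (take-prefix u v len)))
  other-windows : sumWords (1 + (j + L)) (λ s → windowSum L h (drop 1 s)) ≡ 4 ^ 1 * (suc j * 4 ^ j * sumWords L h)
  other-windows = trans (sumWords-suffix 1 (j + L) (λ s → windowSum L h (drop 1 s)) (windowSum L h)
                                         (λ u v len → cong (windowSum L h) (drop-prefix u v len)))
                        (cong (4 ^ 1 *_) (windowSum-exact L h j L≥1))
  collect : ∀ a j X → 4 * a * X + 4 * 1 * ((1 + j) * a * X) ≡ (2 + j) * (4 * a) * X
  collect = solve-∀

windowSum-average : ∀ L h m → 1 ≤ L → 4 ^ L * sumWords m (windowSum L h) ≤ m * 4 ^ m * sumWords L h
windowSum-average L h m L≥1 with L ≤? m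
... | no L≰m = subst (_≤ m * 4 ^ m * sumWords L h) (sym (trans (cong (4 ^ L *_) no-windows) (*-zeroʳ (4 ^ L)))) z≤n
  where
  no-windows : sumWords m (windowSum L h) ≡ 0
  no-windows = trans (sumWords-cong m (λ s len → cong (sumList h)
                       (windows-short L s (subst (_< L) (sym len) (≰⇒> L≰m)))))
                     (trans (sumWords-const m 0) (*-zeroʳ (4 ^ m)))
... | yes L≤m = subst (λ n → 4 ^ L * sumWords n (windowSum L h) ≤ n * 4 ^ n * sumWords L h) (m∸n+n≡m L≤m) (begin
    4 ^ L * sumWords (j + L) (windowSum L h)
  ≡⟨ cong (4 ^ L *_) (windowSum-exact L h j L≥1) ⟩
    4 ^ L * (suc j * 4 ^ j * sumWords L h)
  ≡⟨ regroup (4 ^ L) (suc j) (4 ^ j) (sumWords L h) ⟩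
    suc j * (4 ^ j * 4 ^ L) * sumWords L h
  ≡⟨ cong (λ a → suc j * a * sumWords L h) (sym (^-distribˡ-+-* 4 j L)) ⟩
    suc j * 4 ^ (j + L) * sumWords L h
  ≤⟨ *-monoˡ-≤ (sumWords L h) (*-monoˡ-≤ (4 ^ (j + L)) (subst (_≤ j + L) (+-comm j 1) (+-monoʳ-≤ j L≥1))) ⟩
    (j + L) * 4 ^ (j + L) * sumWords L h ∎)
  where
  open ≤-Reasoning
  j = m ∸ L
  regroup : ∀ a b c d → a * (b * c * d) ≡ b * (c * a) * d
  regroup = solve-∀

-- Summed over all reads of length m, the number of min_p changes weighted by k is at most
-- 4·p·m·4^m: every (k+1)-window of a random read is a random (k+1)-mer.
changes-average : ∀ k p m → 1 ≤ p → p ≤ k → k * sumWords m (windowSum (suc k) (minChange k p)) ≤ 4 * p * m * 4 ^ m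
changes-average k p m p≥1 p≤k = *-cancelˡ-≤ (4 ^ suc k) {{m^n≢0 4 (suc k)}} (begin
    4 ^ suc k * (k * sumWords m (windowSum (suc k) (minChange k p)))
  ≡⟨ swap (4 ^ suc k) k _ ⟩
    k * (4 ^ suc k * sumWords m (windowSum (suc k) (minChange k p)))
  ≤⟨ *-monoʳ-≤ k (windowSum-average (suc k) (minChange k p) m (s≤s z≤n)) ⟩
    k * (m * 4 ^ m * sumWords (suc k) (minChange k p))
  ≡⟨ swap k (m * 4 ^ m) _ ⟩
    m * 4 ^ m * (k * sumWords (suc k) (minChange k p))
  ≤⟨ *-monoʳ-≤ (m * 4 ^ m) density ⟩
    m * 4 ^ m * (4 * p * 4 ^ suc k)
  ≡⟨ regroup m (4 ^ m) p (4 ^ suc k) ⟩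
    4 ^ suc k * (4 * p * m * 4 ^ m) ∎)
  where
  open ≤-Reasoning
  density : k * sumWords (suc k) (minChange k p) ≤ 4 * p * 4 ^ suc k
  density = subst (λ k → k * sumWords (suc k) (minChange k p) ≤ 4 * p * 4 ^ suc k)
                  (m∸n+n≡m p≤k) (minChange-density (k ∸ p) p p≥1)
  swap : ∀ a b c → a * (b * c) ≡ b * (a * c)
  swap = solve-∀
  regroup : ∀ m a p b → m * a * (4 * p * b) ≡ b * (4 * p * m * a)
  regroup = solve-∀

readSum-bound : ∀ k p m → 1 ≤ p → p ≤ k → k ≤ m → sumWords m (partitionSize k p) ≤ 6 * p * m * 4 ^ m
readSum-bound k p m p≥1 p≤k k≤m = begin
    sumWords m (partitionSize k p)
  ≤⟨ sumWords-mono m (λ s len → subst (λ l → partitionSize k p s ≤ l + k + k * C s) len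
                                       (partitionSize-bound k p s (≤-trans p≥1 p≤k))) ⟩
    sumWords m (λ s → m + k + k * C s)
  ≡⟨ sumWords-+ m (λ _ → m + k) (λ s → k * C s) ⟩
    sumWords m (λ _ → m + k) + sumWords m (λ s → k * C s)
  ≡⟨ cong₂ _+_ (sumWords-const m (m + k)) (sumWords-*ˡ m k C) ⟩
    4 ^ m * (m + k) + k * sumWords m C
  ≤⟨ +-mono-≤ (*-monoʳ-≤ (4 ^ m) (+-monoʳ-≤ m k≤m)) (changes-average k p m p≥1 p≤k) ⟩
    4 ^ m * (m + m) + 4 * p * m * 4 ^ m
  ≤⟨ +-monoˡ-≤ (4 * p * m * 4 ^ m) (≤-trans (≤-reflexive (double (4 ^ m) m))
                                            (*-monoˡ-≤ (4 ^ m) (*-monoˡ-≤ m (*-monoʳ-≤ 2 p≥1)))) ⟩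
    2 * p * m * 4 ^ m + 4 * p * m * 4 ^ m
  ≡⟨ add p m (4 ^ m) ⟩
    6 * p * m * 4 ^ m ∎
  where
  open ≤-Reasoning
  C : Word → ℕ
  C = windowSum (suc k) (minChange k p)
  double : ∀ a m → a * (m + m) ≡ 2 * 1 * m * a
  double = solve-∀
  add : ∀ p m a → 2 * p * m * a + 4 * p * m * a ≡ 6 * p * m * a
  add = solve-∀

power-suc : ∀ m N → 4 ^ m * 4 ^ (m * N) ≡ 4 ^ (m * suc N)
power-suc m N = trans (sym (^-distribˡ-+-* 4 m (m * N))) (cong (4 ^_) (sym (*-suc m N)))

allDatasets-const : ∀ N m c → sumList (λ _ → c) (allDatasets N m) ≡ 4 ^ (m * N) * c
allDatasets-const zero m c = cong (λ e → 4 ^ e * c) (sym (*-zeroʳ m))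
allDatasets-const (suc N) m c = begin
    sumList (λ _ → c) (concatMap (λ r → map (r ∷_) (allDatasets N m)) (allReads m))
  ≡⟨ sumList-concatMap (λ _ → c) (λ r → map (r ∷_) (allDatasets N m)) (allReads m) ⟩
    sumList (λ r → sumList (λ _ → c) (map (r ∷_) (allDatasets N m))) (allReads m)
  ≡⟨ sumList-cong (allReads m) (λ r → trans (sumList-map (λ _ → c) (r ∷_) (allDatasets N m))
                                            (allDatasets-const N m c)) ⟩
    sumList (λ _ → 4 ^ (m * N) * c) (allReads m)
  ≡⟨ sumWords-allReads m (λ _ → 4 ^ (m * N) * c) ⟩
    sumWords m (λ _ → 4 ^ (m * N) * c)
  ≡⟨ sumWords-const m (4 ^ (m * N) * c) ⟩
    4 ^ m * (4 ^ (m * N) * c)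
  ≡⟨ sym (*-assoc (4 ^ m) (4 ^ (m * N)) c) ⟩
    4 ^ m * 4 ^ (m * N) * c
  ≡⟨ cong (_* c) (power-suc m N) ⟩
    4 ^ (m * suc N) * c ∎
  where open ≡-Reasoning

-- Summing a per-read quantity f over all datasets: each of the N read slots sees every read
-- 4^(m(N-1)) times (stated multiplied by 4^m to avoid subtraction).
datasetSum : ∀ N m (f : Word → ℕ) → 4 ^ m * sumList (sumList f) (allDatasets N m) ≡ N * 4 ^ (m * N) * sumWords m f
datasetSum zero m f = *-zeroʳ (4 ^ m)
datasetSum (suc N) m f = begin
    4 ^ m * sumList (sumList f) (concatMap (λ r → map (r ∷_) DS) (allReads m))
  ≡⟨ cong (4 ^ m *_) (sumList-concatMap (sumList f) (λ r → map (r ∷_) DS) (allReads m)) ⟩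
    4 ^ m * sumList (λ r → sumList (sumList f) (map (r ∷_) DS)) (allReads m)
  ≡⟨ cong (4 ^ m *_) (sumList-cong (allReads m) first-read) ⟩
    4 ^ m * sumList (λ r → 4 ^ (m * N) * f r + X) (allReads m)
  ≡⟨ cong (4 ^ m *_) (sumWords-allReads m (λ r → 4 ^ (m * N) * f r + X)) ⟩
    4 ^ m * sumWords m (λ r → 4 ^ (m * N) * f r + X)
  ≡⟨ cong (4 ^ m *_) (trans (sumWords-+ m (λ r → 4 ^ (m * N) * f r) (λ _ → X))
                            (cong₂ _+_ (sumWords-*ˡ m (4 ^ (m * N)) f) (sumWords-const m X))) ⟩
    4 ^ m * (4 ^ (m * N) * sumWords m f + 4 ^ m * X)
  ≡⟨ distribute (4 ^ m) (4 ^ (m * N)) (sumWords m f) X ⟩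
    4 ^ m * 4 ^ (m * N) * sumWords m f + 4 ^ m * (4 ^ m * X)
  ≡⟨ cong (4 ^ m * 4 ^ (m * N) * sumWords m f +_) (cong (4 ^ m *_) (datasetSum N m f)) ⟩
    4 ^ m * 4 ^ (m * N) * sumWords m f + 4 ^ m * (N * 4 ^ (m * N) * sumWords m f)
  ≡⟨ collect (4 ^ m) (4 ^ (m * N)) (sumWords m f) N ⟩
    suc N * (4 ^ m * 4 ^ (m * N)) * sumWords m f
  ≡⟨ cong (λ a → suc N * a * sumWords m f) (power-suc m N) ⟩
    suc N * 4 ^ (m * suc N) * sumWords m f ∎
  where
  open ≡-Reasoning
  DS = allDatasets N m
  X = sumList (sumList f) DS
  first-read : ∀ r → sumList (sumList f) (map (r ∷_) DS) ≡ 4 ^ (m * N) * f r + X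
  first-read r = begin
      sumList (sumList f) (map (r ∷_) DS)
    ≡⟨ sumList-map (sumList f) (r ∷_) DS ⟩
      sumList (λ D → f r + sumList f D) DS
    ≡⟨ sumList-+ (λ _ → f r) (sumList f) DS ⟩
      sumList (λ _ → f r) DS + X
    ≡⟨ cong (_+ X) (allDatasets-const N m (f r)) ⟩
      4 ^ (m * N) * f r + X ∎
  distribute : ∀ a b F X → a * (b * F + a * X) ≡ a * b * F + a * (a * X)
  distribute = solve-∀
  collect : ∀ a b F N → a * b * F + a * (N * b * F) ≡ (1 + N) * (a * b) * F
  collect = solve-∀

corollary3p1 : Σ ℕ λ C → (p k m N : ℕ) → 1 ≤ p → p ≤ k → k ≤ m → 1 ≤ N →
    sumTotalPartitionSize k p m N ≤ C * p * (N * m) * 4 ^ (m * N)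
corollary3p1 = 6 , λ p k m N p≥1 p≤k k≤m _ → *-cancelˡ-≤ (4 ^ m) {{m^n≢0 4 m}} (begin
    4 ^ m * sumTotalPartitionSize k p m N
  ≡⟨ datasetSum N m (partitionSize k p) ⟩
    N * 4 ^ (m * N) * sumWords m (partitionSize k p)
  ≤⟨ *-monoʳ-≤ (N * 4 ^ (m * N)) (readSum-bound k p m p≥1 p≤k k≤m) ⟩
    N * 4 ^ (m * N) * (6 * p * m * 4 ^ m)
  ≡⟨ regroup N (4 ^ (m * N)) p m (4 ^ m) ⟩
    4 ^ m * (6 * p * (N * m) * 4 ^ (m * N)) ∎)
  where
  open ≤-Reasoning
  regroup : ∀ N b p m a → N * b * (6 * p * m * a) ≡ a * (6 * p * (N * m) * b)
  regroup = solve-∀
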